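{- $\displaystyle\liminf_{k\to\infty}\frac{\gamma(k)}{k}\leq\frac{9}{10}$ and $\displaystyle\limsup_{k\to\infty}\frac{\gamma(k)}{k}\leq \frac32$.
   Context: The Thue-Morse word is the infinite binary word ${\bf t}={\bf t}_1{\bf t}_2{\bf t}_3\cdots$, where ${\bf t}_i\in\{0,1\}$ has the same parity as the number of $1$'s in the binary expansion of $i-1$. A $k$-anti-power is a word of the form $w_1w_2\cdots w_k$ where $w_1,\ldots,w_k$ are pairwise distinct words all of the same length. Let $\mathcal F(k)$ denote the set of odd positive integers $m$ such that the prefix of ${\bf t}$ of length $km$ is a $k$-anti-power, and let $\gamma(k)=\min\mathcal F(k)$. -}

module Defs where

open import Data.Nat using (ℕ; zero; suc; _+_; _*_; _≤_; _<_)
open import Data.Nat.DivMod using (_%_; _/_)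
open import Data.Bool using (Bool; true; false)
open import Data.List using (List; map; upTo; length)
open import Data.Fin using (Fin; toℕ)
open import Data.Product using (_×_; Σ)
open import Relation.Binary.PropositionalEquality using (_≡_; _≢_)

-- Number of 1's in the binary expansion of n (computed with fuel n, which suffices).
popcountAux : ℕ → ℕ → ℕ
popcountAux zero    m = zero
popcountAux (suc f) m = m % 2 + popcountAux f (m / 2)

popcount : ℕ → ℕ
popcount n = popcountAux n n

parity : ℕ → Bool
parity n with n % 2
... | zero = false
... | suc _ = true

-- Thue–Morse word, 1-indexed as in the paper: t i = parity of popcount (i - 1).
-- We store it 0-indexed: tm n = t_(n+1) = parity (popcount n).
tm : ℕ → Bool
tm n = parity (popcount n)

-- The prefix of length k*m of t, cut into k consecutive blocks of length m:
-- block i (0 ≤ i < k) is t_(i m + 1) ... t_((i+1) m).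
block : (m : ℕ) → ℕ → List Bool
block m i = map (λ j → tm (i * m + j)) (upTo m)

IsAntiPower : (k : ℕ) → (Fin k → List Bool) → Set
IsAntiPower k w =
  (∀ i j → length (w i) ≡ length (w j)) × (∀ i j → i ≢ j → w i ≢ w j)

PrefixAntiPower : ℕ → ℕ → Set
PrefixAntiPower k m = IsAntiPower k (λ i → block m (toℕ i))

InF : ℕ → ℕ → Set
InF k m = (m % 2 ≡ 1) × PrefixAntiPower k m

IsGamma : ℕ → ℕ → Set
IsGamma k g = InF k g × (∀ m → InF k m → g ≤ m)

-- The Thue–Morse word t is the fixed point of the substitution 0 ↦ 01, 1 ↦ 10, and two of
-- its factors of length at least 4 can only agree if they start at positions of equal
-- parity; such factors are images of agreeing factors of half the length.  So if two blocks
-- of odd length m with 3·2^a < m coincide at positions i m < j m < 2^(a+2) m, we may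
-- desubstitute a + 1 times: then 2^(a+1) divides (j − i) m, hence j = i + 2^(a+1), and we
-- are left with a position P, small when k is small compared with m, at which the two
-- letters of t starting at P and at P + m agree.  For m = 3n + 1 (n = 2^(b+1)) and for
-- m = 4n + 3 (n = 2^a) the binary expansion of the positions shows that this never happens,
-- so such m lie in 𝓕(k) as long as 3k + 10 ≤ 10n, resp. k + 3 ≤ 4n.
--
-- For the lim inf take n = 4^(c+1) = 3u + 1 and k = 10u, so that γ(k) ≤ 9u + 4 ≈ 9k/10.
-- For the lim sup choose the power of two n with 2n ≤ k + 3 < 4n: if k ≤ 3n then
-- γ(k) ≤ 3n + 1 ≲ 3k/2, and otherwise γ(k) ≤ 4n + 3 ≲ 4k/3.
module Submission where

open import Defs
open import Data.Nat using (ℕ; suc; _+_; _*_; _≤_; _<_)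
open import Data.Product using (_×_; Σ; ∃)

open import Data.Bool using (true; false; not; _xor_)
open import Data.Bool.Properties
  using (not-¬; not-injective; not-involutive; not-distribˡ-xor; xor-assoc; xor-comm; xor-identityʳ; true-xor)
  renaming (_≟_ to _≟ᴮ_)
open import Data.Empty using (⊥; ⊥-elim)
open import Data.Fin using (Fin; toℕ)
open import Data.Fin.Properties using (toℕ<n; toℕ-injective; all?) renaming (_≟_ to _≟ᶠ_)
open import Data.List using (map; upTo; length; _∷_)
open import Data.List.Membership.Propositional using (_∈_)
open import Data.List.Membership.Propositional.Properties using (∈-upTo⁺)
open import Data.List.Properties using (∷-injective; length-map; length-upTo; ≡-dec)
open import Data.List.Relation.Unary.Any using (here; there)
open import Data.Nat using (zero; _^_; _/_; _%_; _∸_; z≤n; s≤s; s≤s⁻¹)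
open import Data.Nat.DivMod using (m/n<m; m≡m%n+[m/n]*n; m%n<n; [m+kn]%n≡m%n; +-distrib-/-∣ʳ; m<n⇒m%n≡m; m<n⇒m/n≡0; m*n/n≡m)
open import Data.Nat.Divisibility using (_∣_; divides; 1∣_; ∣-trans; m∣m*n; n∣m*n; ∣m+n∣m⇒∣n; ∣1⇒≡1; *-cancelˡ-∣; *-monoʳ-∣)
open import Data.Nat.Properties
open import Data.Nat.Tactic.RingSolver using (solve-∀)
open import Data.Product using (_,_; ∃₂; proj₁; proj₂)
open import Data.Sum using (inj₁; inj₂)
open import Function using (_∘_)
open import Relation.Binary.Definitions using (tri<; tri≈; tri>)
open import Relation.Binary.PropositionalEquality
open import Relation.Nullary using (¬_; Dec; yes; no; ¬?)
open import Relation.Nullary.Decidable using (_×-dec_; _→-dec_; map′)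
open import Relation.Unary using (Decidable)

-- Binary digits and the letters of t

popcountAux-zero : ∀ f → popcountAux f 0 ≡ 0
popcountAux-zero zero    = refl
popcountAux-zero (suc f) = popcountAux-zero f

n≤1+f⇒n/2≤f : ∀ {n f} → n ≤ suc f → n / 2 ≤ f
n≤1+f⇒n/2≤f {zero}  _      = z≤n
n≤1+f⇒n/2≤f {suc n} n≤1+f = ≤-pred (≤-trans (m/n<m (suc n) 2 (s≤s (s≤s z≤n))) n≤1+f)

popcountAux-fuel : ∀ f g {n} → n ≤ f → n ≤ g → popcountAux f n ≡ popcountAux g n
popcountAux-fuel zero    g       z≤n _   = sym (popcountAux-zero g)
popcountAux-fuel (suc f) zero    _   z≤n = popcountAux-zero (suc f)
popcountAux-fuel (suc f) (suc g) {n} n≤f n≤g =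
  cong (n % 2 +_) (popcountAux-fuel f g (n≤1+f⇒n/2≤f n≤f) (n≤1+f⇒n/2≤f n≤g))

parity-suc : ∀ n → parity (suc n) ≡ not (parity n)
parity-suc zero    = refl
parity-suc (suc n) = sym (trans (cong not (parity-suc n)) (not-involutive (parity n)))

parity-+ : ∀ m n → parity (m + n) ≡ parity m xor parity n
parity-+ zero    n = refl
parity-+ (suc m) n = begin
  parity (suc (m + n))          ≡⟨ parity-suc (m + n) ⟩
  not (parity (m + n))          ≡⟨ cong not (parity-+ m n) ⟩
  not (parity m xor parity n)   ≡⟨ not-distribˡ-xor (parity m) (parity n) ⟩
  not (parity m) xor parity n   ≡⟨ cong (_xor parity n) (sym (parity-suc m)) ⟩
  parity (suc m) xor parity n   ∎
  where open ≡-Reasoning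

divMod-2^ : ∀ b x → ∃₂ λ q r → r < 2 ^ b × x ≡ 2 ^ b * q + r
divMod-2^ b x = x / p , x % p , m%n<n x p ,
  trans (m≡m%n+[m/n]*n x p) (trans (+-comm (x % p) _) (cong (_+ x % p) (*-comm (x / p) p)))
  where
  p = 2 ^ b
  instance _ = m^n≢0 2 b

popcount-2n+ρ : ∀ n {ρ} → ρ < 2 → popcount (2 * n + ρ) ≡ popcount n + popcount ρ
popcount-2n+ρ n {ρ} ρ<2 = begin
  popcountAux x x                ≡⟨ popcountAux-fuel x (suc x) ≤-refl (n≤1+n x) ⟩
  x % 2 + popcountAux x (x / 2)  ≡⟨ cong₂ (λ a b → a + popcountAux x b) x%2≡ρ x/2≡n ⟩
  ρ + popcountAux x n            ≡⟨ cong (ρ +_) (popcountAux-fuel x n n≤x ≤-refl) ⟩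
  ρ + popcount n                 ≡⟨ +-comm ρ (popcount n) ⟩
  popcount n + ρ                 ≡⟨ cong (popcount n +_) (popcount-digit ρ<2) ⟩
  popcount n + popcount ρ        ∎
  where
  open ≡-Reasoning
  x = 2 * n + ρ
  x≡ρ+n*2 : x ≡ ρ + n * 2
  x≡ρ+n*2 = trans (+-comm (2 * n) ρ) (cong (ρ +_) (*-comm 2 n))
  x%2≡ρ : x % 2 ≡ ρ
  x%2≡ρ = trans (cong (_% 2) x≡ρ+n*2) (trans ([m+kn]%n≡m%n ρ n 2) (m<n⇒m%n≡m ρ<2))
  x/2≡n : x / 2 ≡ n
  x/2≡n = trans (cong (_/ 2) x≡ρ+n*2)
                (trans (+-distrib-/-∣ʳ ρ (n∣m*n n)) (cong₂ _+_ (m<n⇒m/n≡0 ρ<2) (m*n/n≡m n 2)))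
  n≤x : n ≤ x
  n≤x = ≤-trans (m≤m+n n (n + 0)) (m≤m+n (2 * n) ρ)
  popcount-digit : ∀ {ρ} → ρ < 2 → ρ ≡ popcount ρ
  popcount-digit (s≤s z≤n)       = refl
  popcount-digit (s≤s (s≤s z≤n)) = refl

tm-2n+ρ : ∀ n {ρ} → ρ < 2 → tm (2 * n + ρ) ≡ tm n xor tm ρ
tm-2n+ρ n {ρ} ρ<2 = trans (cong parity (popcount-2n+ρ n ρ<2)) (parity-+ (popcount n) (popcount ρ))

tm-2n : ∀ n → tm (2 * n) ≡ tm n
tm-2n n = trans (cong tm (sym (+-identityʳ (2 * n)))) (trans (tm-2n+ρ n (s≤s z≤n)) (xor-identityʳ (tm n)))

tm-2n+1 : ∀ n → tm (2 * n + 1) ≡ not (tm n)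
tm-2n+1 n = trans (tm-2n+ρ n (s≤s (s≤s z≤n))) (trans (xor-comm (tm n) true) (true-xor (tm n)))

tm-split : ∀ b u {v} → v < 2 ^ b → tm (2 ^ b * u + v) ≡ tm u xor tm v
tm-split zero    u (s≤s z≤n) =
  trans (cong tm (trans (+-identityʳ (1 * u)) (*-identityˡ u))) (sym (xor-identityʳ (tm u)))
tm-split (suc b) u {v} v<2p with divMod-2^ 1 v
... | v′ , ρ , ρ<2 , refl = begin
  tm (2 * p * u + (2 * v′ + ρ))  ≡⟨ cong tm (regroup p u v′ ρ) ⟩
  tm (2 * (p * u + v′) + ρ)      ≡⟨ tm-2n+ρ (p * u + v′) ρ<2 ⟩
  tm (p * u + v′) xor tm ρ       ≡⟨ cong (_xor tm ρ) (tm-split b u v′<p) ⟩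
  (tm u xor tm v′) xor tm ρ      ≡⟨ xor-assoc (tm u) (tm v′) (tm ρ) ⟩
  tm u xor (tm v′ xor tm ρ)      ≡⟨ cong (tm u xor_) (sym (tm-2n+ρ v′ ρ<2)) ⟩
  tm u xor tm (2 * v′ + ρ)       ∎
  where
  open ≡-Reasoning
  p = 2 ^ b
  regroup : ∀ p u v′ ρ → 2 * p * u + (2 * v′ + ρ) ≡ 2 * (p * u + v′) + ρ
  regroup = solve-∀
  v′<p : v′ < p
  v′<p = *-cancelˡ-< 2 v′ p (≤-trans (s≤s (m≤m+n (2 * v′) ρ)) v<2p)

-- Writing y = 2^b e + z with e ∈ {0, 1}, this is t(e + 3) = t(e).
tm-+3*2^ : ∀ b {y} → y < 2 ^ suc b → tm (y + 3 * 2 ^ b) ≡ tm y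
tm-+3*2^ b {y} y<2p with divMod-2^ b y
... | e , z , z<p , refl = begin
  tm (p * e + z + 3 * p)   ≡⟨ cong tm (regroup p e z) ⟩
  tm (p * (e + 3) + z)     ≡⟨ tm-split b (e + 3) z<p ⟩
  tm (e + 3) xor tm z      ≡⟨ cong (_xor tm z) (tm-+3 e<2) ⟩
  tm e xor tm z            ≡⟨ sym (tm-split b e z<p) ⟩
  tm (p * e + z)           ∎
  where
  open ≡-Reasoning
  p = 2 ^ b
  regroup : ∀ p e z → p * e + z + 3 * p ≡ p * (e + 3) + z
  regroup = solve-∀
  e<2 : e < 2
  e<2 = *-cancelˡ-< p e 2 (≤-<-trans (m≤m+n (p * e) z) (subst (p * e + z <_) (*-comm 2 p) y<2p))
  tm-+3 : ∀ {e} → e < 2 → tm (e + 3) ≡ tm e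
  tm-+3 (s≤s z≤n)       = refl
  tm-+3 (s≤s (s≤s z≤n)) = refl

tm-2n≢tm-2n+1 : ∀ n → tm (2 * n) ≢ tm (2 * n + 1)
tm-2n≢tm-2n+1 n e = not-¬ refl (trans (sym (tm-2n n)) (trans e (tm-2n+1 n)))

tm-no-triple : ∀ x → tm x ≡ tm (x + 1) → tm (x + 1) ≡ tm (x + 2) → ⊥
tm-no-triple x e₁ e₂ with divMod-2^ 1 x
... | y , _ , s≤s z≤n , refl =
  tm-2n≢tm-2n+1 y (subst₂ (λ i j → tm i ≡ tm j) (+-identityʳ (2 * y)) (cong (_+ 1) (+-identityʳ (2 * y))) e₁)
... | y , _ , s≤s (s≤s z≤n) , refl =
  tm-2n≢tm-2n+1 (suc y) (subst₂ (λ i j → tm i ≡ tm j) (2y+1+1≡2[1+y] y) (2y+1+2≡2[1+y]+1 y) e₂)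
  where
  2y+1+1≡2[1+y] : ∀ y → 2 * y + 1 + 1 ≡ 2 * suc y
  2y+1+1≡2[1+y] = solve-∀
  2y+1+2≡2[1+y]+1 : ∀ y → 2 * y + 1 + 2 ≡ 2 * suc y + 1
  2y+1+2≡2[1+y]+1 = solve-∀

tm-no-double-antiperiod-3 : ∀ x → tm x ≡ not (tm (x + 3)) → tm (x + 1) ≡ not (tm (x + 4)) → ⊥
tm-no-double-antiperiod-3 x e₁ e₂ with divMod-2^ 1 x
... | y , _ , s≤s z≤n , refl = tm-no-triple y y≈y+1 (trans (sym y≈y+1) y≈y+2)
  where
  open ≡-Reasoning
  2y+0+3≡2[y+1]+1 : ∀ y → 2 * y + 0 + 3 ≡ 2 * (y + 1) + 1
  2y+0+3≡2[y+1]+1 = solve-∀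
  2y+0+4≡2[y+2] : ∀ y → 2 * y + 0 + 4 ≡ 2 * (y + 2)
  2y+0+4≡2[y+2] = solve-∀

  y≈y+1 : tm y ≡ tm (y + 1)
  y≈y+1 = begin
    tm y                          ≡⟨ sym (tm-2n y) ⟩
    tm (2 * y)                    ≡⟨ cong tm (sym (+-identityʳ (2 * y))) ⟩
    tm (2 * y + 0)                ≡⟨ e₁ ⟩
    not (tm (2 * y + 0 + 3))      ≡⟨ cong (not ∘ tm) (2y+0+3≡2[y+1]+1 y) ⟩
    not (tm (2 * (y + 1) + 1))    ≡⟨ cong not (tm-2n+1 (y + 1)) ⟩
    not (not (tm (y + 1)))        ≡⟨ not-involutive _ ⟩
    tm (y + 1)                    ∎
  y≈y+2 : tm y ≡ tm (y + 2)
  y≈y+2 = not-injective (begin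
    not (tm y)                    ≡⟨ sym (tm-2n+1 y) ⟩
    tm (2 * y + 1)                ≡⟨ cong (λ z → tm (z + 1)) (sym (+-identityʳ (2 * y))) ⟩
    tm (2 * y + 0 + 1)            ≡⟨ e₂ ⟩
    not (tm (2 * y + 0 + 4))      ≡⟨ cong (not ∘ tm) (2y+0+4≡2[y+2] y) ⟩
    not (tm (2 * (y + 2)))        ≡⟨ cong not (tm-2n (y + 2)) ⟩
    not (tm (y + 2))              ∎)
... | y , _ , s≤s (s≤s z≤n) , refl = tm-no-triple y (trans y≈y+2 (sym y+1≈y+2)) y+1≈y+2
  where
  open ≡-Reasoning
  2y+1+3≡2[y+2] : ∀ y → 2 * y + 1 + 3 ≡ 2 * (y + 2)
  2y+1+3≡2[y+2] = solve-∀
  2[y+1]≡2y+1+1 : ∀ y → 2 * (y + 1) ≡ 2 * y + 1 + 1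
  2[y+1]≡2y+1+1 = solve-∀
  2y+1+4≡2[y+2]+1 : ∀ y → 2 * y + 1 + 4 ≡ 2 * (y + 2) + 1
  2y+1+4≡2[y+2]+1 = solve-∀

  y≈y+2 : tm y ≡ tm (y + 2)
  y≈y+2 = not-injective (begin
    not (tm y)                    ≡⟨ sym (tm-2n+1 y) ⟩
    tm (2 * y + 1)                ≡⟨ e₁ ⟩
    not (tm (2 * y + 1 + 3))      ≡⟨ cong (not ∘ tm) (2y+1+3≡2[y+2] y) ⟩
    not (tm (2 * (y + 2)))        ≡⟨ cong not (tm-2n (y + 2)) ⟩
    not (tm (y + 2))              ∎)
  y+1≈y+2 : tm (y + 1) ≡ tm (y + 2)
  y+1≈y+2 = begin
    tm (y + 1)                    ≡⟨ sym (tm-2n (y + 1)) ⟩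
    tm (2 * (y + 1))              ≡⟨ cong tm (2[y+1]≡2y+1+1 y) ⟩
    tm (2 * y + 1 + 1)            ≡⟨ e₂ ⟩
    not (tm (2 * y + 1 + 4))      ≡⟨ cong (not ∘ tm) (2y+1+4≡2[y+2]+1 y) ⟩
    not (tm (2 * (y + 2) + 1))    ≡⟨ cong not (tm-2n+1 (y + 2)) ⟩
    not (not (tm (y + 2)))        ≡⟨ not-involutive _ ⟩
    tm (y + 2)                    ∎

-- Desubstitution

xor-cancelʳ : ∀ {x y} z → x xor z ≡ y xor z → x ≡ y
xor-cancelʳ {false} {false} _     _  = refl
xor-cancelʳ {true}  {true}  _     _  = refl
xor-cancelʳ {false} {true}  false ()
xor-cancelʳ {false} {true}  true  ()
xor-cancelʳ {true}  {false} false ()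
xor-cancelʳ {true}  {false} true  ()

-- Agree c L p q: the factors of t of length ⌈L / c⌉ at p and q coincide.  Desubstituting
-- s times turns an agreement of length L (c = 1) into one at scale c = 2^s.
Agree : ℕ → ℕ → ℕ → ℕ → Set
Agree c L p q = ∀ r → c * r < L → tm (p + r) ≡ tm (q + r)

agree-sym : ∀ {c L p q} → Agree c L p q → Agree c L q p
agree-sym agree r cr<L = sym (agree r cr<L)

¬agree-even-odd : ∀ {c L} a b → 3 * c < L → ¬ Agree c L (2 * a) (2 * b + 1)
¬agree-even-odd {c} {L} a b 3c<L agree =
  tm-no-triple b (halves a b e₀ e₁)
    (subst (λ i → tm (b + 1) ≡ tm i) (+-assoc b 1 1) (halves (a + 1) (b + 1) e₂ e₃))
  where
  2n+1+1≡2[n+1] : ∀ n → 2 * n + 1 + 1 ≡ 2 * (n + 1)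
  2n+1+1≡2[n+1] = solve-∀
  2n+2≡2[n+1] : ∀ n → 2 * n + 2 ≡ 2 * (n + 1)
  2n+2≡2[n+1] = solve-∀
  2n+1+2≡2[n+1]+1 : ∀ n → 2 * n + 1 + 2 ≡ 2 * (n + 1) + 1
  2n+1+2≡2[n+1]+1 = solve-∀
  2n+3≡2[n+1]+1 : ∀ n → 2 * n + 3 ≡ 2 * (n + 1) + 1
  2n+3≡2[n+1]+1 = solve-∀
  2n+1+3≡2[n+1+1] : ∀ n → 2 * n + 1 + 3 ≡ 2 * (n + 1 + 1)
  2n+1+3≡2[n+1+1] = solve-∀

  agree≤3 : ∀ r → r ≤ 3 → tm (2 * a + r) ≡ tm (2 * b + 1 + r)
  agree≤3 r r≤3 = agree r (≤-<-trans (*-monoʳ-≤ c r≤3) (subst (_< L) (*-comm 3 c) 3c<L))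

  e₀ : tm (2 * a) ≡ tm (2 * b + 1)
  e₀ = subst₂ (λ i j → tm i ≡ tm j) (+-identityʳ (2 * a)) (+-identityʳ (2 * b + 1)) (agree≤3 0 z≤n)
  e₁ : tm (2 * a + 1) ≡ tm (2 * (b + 1))
  e₁ = subst (λ j → tm (2 * a + 1) ≡ tm j) (2n+1+1≡2[n+1] b) (agree≤3 1 (s≤s z≤n))
  e₂ : tm (2 * (a + 1)) ≡ tm (2 * (b + 1) + 1)
  e₂ = subst₂ (λ i j → tm i ≡ tm j) (2n+2≡2[n+1] a) (2n+1+2≡2[n+1]+1 b) (agree≤3 2 (s≤s (s≤s z≤n)))
  e₃ : tm (2 * (a + 1) + 1) ≡ tm (2 * (b + 1 + 1))
  e₃ = subst₂ (λ i j → tm i ≡ tm j) (2n+3≡2[n+1]+1 a) (2n+1+3≡2[n+1+1] b) (agree≤3 3 (s≤s (s≤s (s≤s z≤n))))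

  halves : ∀ a b → tm (2 * a) ≡ tm (2 * b + 1) → tm (2 * a + 1) ≡ tm (2 * (b + 1)) → tm b ≡ tm (b + 1)
  halves a b even≈odd odd≈even = begin
    tm b                  ≡⟨ sym (not-involutive (tm b)) ⟩
    not (not (tm b))      ≡⟨ cong not (sym (tm-2n+1 b)) ⟩
    not (tm (2 * b + 1))  ≡⟨ cong not (sym even≈odd) ⟩
    not (tm (2 * a))      ≡⟨ cong not (tm-2n a) ⟩
    not (tm a)            ≡⟨ sym (tm-2n+1 a) ⟩
    tm (2 * a + 1)        ≡⟨ odd≈even ⟩
    tm (2 * (b + 1))      ≡⟨ tm-2n (b + 1) ⟩
    tm (b + 1)            ∎
    where open ≡-Reasoning

agree-sameParity : ∀ {c L p q} → 3 * c < L → Agree c L p q →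
  ∃₂ λ a b → ∃ λ ρ → ρ < 2 × p ≡ 2 * a + ρ × q ≡ 2 * b + ρ
agree-sameParity {c} {L} {p} {q} 3c<L agree with divMod-2^ 1 p | divMod-2^ 1 q
... | a , _ , s≤s z≤n       , refl | b , _ , s≤s z≤n       , refl = a , b , 0 , s≤s z≤n , refl , refl
... | a , _ , s≤s (s≤s z≤n) , refl | b , _ , s≤s (s≤s z≤n) , refl = a , b , 1 , s≤s (s≤s z≤n) , refl , refl
... | a , _ , s≤s z≤n       , refl | b , _ , s≤s (s≤s z≤n) , refl =
  ⊥-elim (¬agree-even-odd {c} {L} a b 3c<L (subst (λ i → Agree c L i (2 * b + 1)) (+-identityʳ (2 * a)) agree))
... | a , _ , s≤s (s≤s z≤n) , refl | b , _ , s≤s z≤n       , refl =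
  ⊥-elim (¬agree-even-odd {c} {L} b a 3c<L
    (subst (λ i → Agree c L i (2 * a + 1)) (+-identityʳ (2 * b)) (agree-sym {c} {L} {2 * a + 1} {2 * b + 0} agree)))

agree-halve : ∀ {c L ρ} a b → ρ < 2 → Agree c L (2 * a + ρ) (2 * b + ρ) → Agree (2 * c) L a b
agree-halve {c} {L} {ρ} a b ρ<2 agree r 2cr<L = xor-cancelʳ (tm ρ) (begin
  tm (a + r) xor tm ρ      ≡⟨ sym (tm-2n+ρ (a + r) ρ<2) ⟩
  tm (2 * (a + r) + ρ)     ≡⟨ cong tm (regroup a r ρ) ⟩
  tm (2 * a + ρ + 2 * r)   ≡⟨ agree (2 * r) (subst (_< L) (rescale c r) 2cr<L) ⟩
  tm (2 * b + ρ + 2 * r)   ≡⟨ cong tm (sym (regroup b r ρ)) ⟩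
  tm (2 * (b + r) + ρ)     ≡⟨ tm-2n+ρ (b + r) ρ<2 ⟩
  tm (b + r) xor tm ρ      ∎)
  where
  open ≡-Reasoning
  regroup : ∀ a r ρ → 2 * (a + r) + ρ ≡ 2 * a + ρ + 2 * r
  regroup = solve-∀
  rescale : ∀ c r → 2 * c * r ≡ c * (2 * r)
  rescale = solve-∀

-- Each of the s halvings needs 3 c′ < L at the current scale c′, which is at most 2^(s−1) c.
agree-desubstitute : ∀ s {c L p q} → 3 * c * 2 ^ s < 2 * L → Agree c L p q →
  ∃₂ λ p′ q′ → ∃ λ ρ → p ≡ 2 ^ s * p′ + ρ × q ≡ 2 ^ s * q′ + ρ × Agree (2 ^ s * c) L p′ q′
agree-desubstitute zero {c} {L} {p} {q} _ agree =
  p , q , 0 , sym (1*n+0≡n p) , sym (1*n+0≡n q) , subst (λ c′ → Agree c′ L p q) (sym (*-identityˡ c)) agree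
  where
  1*n+0≡n : ∀ n → 1 * n + 0 ≡ n
  1*n+0≡n = solve-∀
agree-desubstitute (suc s) {c} {L} {p} {q} bound agree
  with agree-sameParity {c} {L} {p} {q} 3c<L agree
  where
  3c<L : 3 * c < L
  3c<L = *-cancelˡ-< 2 (3 * c) L (≤-<-trans (2*n≤n*2^[1+s] (3 * c)) bound)
    where
    2*n≤n*2^[1+s] : ∀ n → 2 * n ≤ n * 2 ^ suc s
    2*n≤n*2^[1+s] n = subst (_≤ n * 2 ^ suc s) (*-comm n 2) (*-monoʳ-≤ n (*-monoʳ-≤ 2 (m^n>0 2 s)))
... | a , b , ρ , ρ<2 , refl , refl
  with agree-desubstitute s {2 * c} {L} {a} {b} (subst (_< 2 * L) (regroup c (2 ^ s)) bound)
                                                 (agree-halve {c} {L} a b ρ<2 agree)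
  where
  regroup : ∀ c x → 3 * c * (2 * x) ≡ 3 * (2 * c) * x
  regroup = solve-∀
... | a′ , b′ , σ , refl , refl , agree′ =
  a′ , b′ , 2 * σ + ρ , regroup (2 ^ s) a′ σ ρ , regroup (2 ^ s) b′ σ ρ ,
  subst (λ c′ → Agree c′ L a′ b′) (reassoc (2 ^ s) c) agree′
  where
  regroup : ∀ x a σ ρ → 2 * (x * a + σ) + ρ ≡ 2 * x * a + (2 * σ + ρ)
  regroup = solve-∀
  reassoc : ∀ x c → x * (2 * c) ≡ 2 * x * c
  reassoc = solve-∀

-- Repeated blocks

¬2∣2n+1 : ∀ n → ¬ 2 ∣ 2 * n + 1
¬2∣2n+1 n 2∣2n+1 with ∣1⇒≡1 (∣m+n∣m⇒∣n 2∣2n+1 (m∣m*n n))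
... | ()

2^∣d*odd⇒2^∣d : ∀ s d h → 2 ^ s ∣ d * (2 * h + 1) → 2 ^ s ∣ d
2^∣d*odd⇒2^∣d zero    d h _ = 1∣ d
2^∣d*odd⇒2^∣d (suc s) d h 2^[1+s]∣ with divMod-2^ 1 d
... | e , _ , s≤s z≤n , refl =
  subst (2 ^ suc s ∣_) (sym (+-identityʳ (2 * e)))
    (*-monoʳ-∣ 2 (2^∣d*odd⇒2^∣d s e h (*-cancelˡ-∣ 2 (subst (2 ^ suc s ∣_) (even*odd e h) 2^[1+s]∣))))
  where
  even*odd : ∀ e h → (2 * e + 0) * (2 * h + 1) ≡ 2 * (e * (2 * h + 1))
  even*odd = solve-∀
... | e , _ , s≤s (s≤s z≤n) , refl =
  ⊥-elim (¬2∣2n+1 (2 * e * h + e + h) (∣-trans (m∣m*n (2 ^ s)) (subst (2 ^ suc s ∣_) (odd*odd e h) 2^[1+s]∣)))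
  where
  odd*odd : ∀ e h → (2 * e + 1) * (2 * h + 1) ≡ 2 * (2 * e * h + e + h) + 1
  odd*odd = solve-∀

N∣d⇒0<d<2N⇒d≡N : ∀ {N d} → N ∣ d → 0 < d → d < 2 * N → d ≡ N
N∣d⇒0<d<2N⇒d≡N {N} (divides zero          refl) () _
N∣d⇒0<d<2N⇒d≡N {N} (divides (suc zero)    refl) _ _ = +-identityʳ N
N∣d⇒0<d<2N⇒d≡N {N} (divides (suc (suc q)) refl) _ d<2N =
  ⊥-elim (<⇒≱ d<2N (*-monoˡ-≤ N {2} {suc (suc q)} (s≤s (s≤s z≤n))))

2^*Q≡2^*P+d*odd⇒Q≡P+odd : ∀ s h {P Q d} → let N = 2 ^ s ; m = 2 * h + 1 in
  N * Q ≡ N * P + d * m → 0 < d → d < 2 * N → Q ≡ P + m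
2^*Q≡2^*P+d*odd⇒Q≡P+odd s h {P} {Q} {d} NQ≡NP+dm 0<d d<2N =
  *-cancelˡ-≡ Q (P + m) N (begin
    N * Q          ≡⟨ NQ≡NP+dm ⟩
    N * P + d * m  ≡⟨ cong (λ x → N * P + x * m) d≡N ⟩
    N * P + N * m  ≡⟨ sym (*-distribˡ-+ N P m) ⟩
    N * (P + m)    ∎)
  where
  open ≡-Reasoning
  N = 2 ^ s
  m = 2 * h + 1
  instance _ = m^n≢0 2 s
  N∣dm : N ∣ d * m
  N∣dm = ∣m+n∣m⇒∣n (subst (N ∣_) NQ≡NP+dm (m∣m*n Q)) (m∣m*n P)
  d≡N : d ≡ N
  d≡N = N∣d⇒0<d<2N⇒d≡N (2^∣d*odd⇒2^∣d s d h N∣dm) 0<d d<2N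

map-≡⇒≗ : ∀ {A B : Set} {f g : A → B} xs → map f xs ≡ map g xs → ∀ {x} → x ∈ xs → f x ≡ g x
map-≡⇒≗ (_ ∷ _)  eq (here refl)  = proj₁ (∷-injective eq)
map-≡⇒≗ (_ ∷ xs) eq (there x∈xs) = map-≡⇒≗ xs (proj₂ (∷-injective eq)) x∈xs

block-agree : ∀ m i j → block m i ≡ block m j → Agree 1 m (i * m) (j * m)
block-agree m i j eq r 1*r<m = map-≡⇒≗ (upTo m) eq (∈-upTo⁺ (subst (_< m) (*-identityˡ r) 1*r<m))

repeated-block : ∀ a h {i j} → let N = 2 ^ suc a ; m = 2 * h + 1 in
  3 * 2 ^ a < m → i < j → j < 2 * N → block m i ≡ block m j →
  ∃ λ P → N * (P + m) ≤ j * m × Agree N m P (P + m)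
repeated-block a h {i} {j} 3·2^a<m i<j j<2N eq
  with agree-desubstitute (suc a) {1} {m} {i * m} {j * m} bound (block-agree m i j eq)
  where
  m = 2 * h + 1
  bound : 3 * 1 * 2 ^ suc a < 2 * m
  bound = subst (_< 2 * m) (double (2 ^ a)) (*-monoʳ-< 2 3·2^a<m)
    where
    double : ∀ x → 2 * (3 * x) ≡ 3 * 1 * (2 * x)
    double = solve-∀
... | P , Q , ρ , im≡NP+ρ , jm≡NQ+ρ , agree =
  P , N[P+m]≤jm , subst₂ (λ c q → Agree c m P q) (*-identityʳ N) Q≡P+m agree
  where
  N = 2 ^ suc a
  m = 2 * h + 1
  d = j ∸ i
  NQ≡NP+dm : N * Q ≡ N * P + d * m
  NQ≡NP+dm = +-cancelʳ-≡ ρ _ _ (begin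
    N * Q + ρ          ≡⟨ sym jm≡NQ+ρ ⟩
    j * m              ≡⟨ cong (_* m) (sym (m+[n∸m]≡n (<⇒≤ i<j))) ⟩
    (i + d) * m        ≡⟨ *-distribʳ-+ m i d ⟩
    i * m + d * m      ≡⟨ cong (_+ d * m) im≡NP+ρ ⟩
    N * P + ρ + d * m  ≡⟨ swap (N * P) ρ (d * m) ⟩
    N * P + d * m + ρ  ∎)
    where
    open ≡-Reasoning
    swap : ∀ x y z → x + y + z ≡ x + z + y
    swap = solve-∀
  Q≡P+m : Q ≡ P + m
  Q≡P+m = 2^*Q≡2^*P+d*odd⇒Q≡P+odd (suc a) h NQ≡NP+dm (m<n⇒0<n∸m i<j) (≤-<-trans (m∸n≤m j i) j<2N)
  N[P+m]≤jm : N * (P + m) ≤ j * m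
  N[P+m]≤jm = subst₂ _≤_ (cong (N *_) Q≡P+m) (sym jm≡NQ+ρ) (m≤m+n (N * Q) ρ)

length-block : ∀ m i → length (block m i) ≡ m
length-block m i = trans (length-map (λ r → tm (i * m + r)) (upTo m)) (length-upTo m)

block-lengths : ∀ k m (i j : Fin k) → length (block m (toℕ i)) ≡ length (block m (toℕ j))
block-lengths k m i j = trans (length-block m (toℕ i)) (sym (length-block m (toℕ j)))

prefixAntiPower-intro : ∀ k m → (∀ {i j} → i < j → j < k → block m i ≢ block m j) → PrefixAntiPower k m
prefixAntiPower-intro k m distinct = block-lengths k m , different
  where
  different : ∀ i j → i ≢ j → block m (toℕ i) ≢ block m (toℕ j)
  different i j i≢j eq with <-cmp (toℕ i) (toℕ j)
  ... | tri< i<j _ _ = distinct i<j (toℕ<n j) eq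
  ... | tri≈ _ i≡j _ = i≢j (toℕ-injective i≡j)
  ... | tri> _ _ j<i = distinct j<i (toℕ<n i) (sym eq)

[2n+1]%2≡1 : ∀ n → (2 * n + 1) % 2 ≡ 1
[2n+1]%2≡1 n = trans (cong (_% 2) (trans (+-comm (2 * n) 1) (cong (1 +_) (*-comm 2 n)))) ([m+kn]%n≡m%n 1 n 2)

-- A repeated pair of blocks i < j < k yields a P with N (P + m) ≤ j m, so m + N (P + m) ≤ k m.
∈F-criterion : ∀ a h k → let N = 2 ^ suc a ; m = 2 * h + 1 in
  3 * 2 ^ a < m → k ≤ 2 * N →
  (∀ P → m + N * (P + m) ≤ k * m → ¬ Agree N m P (P + m)) → InF k m
∈F-criterion a h k 3·2^a<m k≤2N no-agreement = [2n+1]%2≡1 h , prefixAntiPower-intro k m distinct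
  where
  m = 2 * h + 1
  distinct : ∀ {i j} → i < j → j < k → block m i ≢ block m j
  distinct {i} {j} i<j j<k eq =
    let P , N[P+m]≤jm , agree = repeated-block a h 3·2^a<m i<j (<-≤-trans j<k k≤2N) eq
    in  no-agreement P (≤-trans (+-monoʳ-≤ m N[P+m]≤jm) (*-monoˡ-≤ m j<k)) agree

-- Two families of elements of 𝓕(k)

round-up-even : ∀ x → ∃₂ λ y r → r ≤ 1 × x + r ≡ 2 * y
round-up-even x with divMod-2^ 1 x
... | y , _ , s≤s z≤n       , refl = y , 0 , z≤n , trans (+-identityʳ (2 * y + 0)) (+-identityʳ (2 * y))
... | y , _ , s≤s (s≤s z≤n) , refl = suc y , 1 , s≤s z≤n , 2y+1+1≡2[1+y] y
  where
  2y+1+1≡2[1+y] : ∀ y → 2 * y + 1 + 1 ≡ 2 * suc y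
  2y+1+1≡2[1+y] = solve-∀

-- At the even one, 2y, of the positions P, P + 1, the letters of t at 2y and 2y + m are
-- t(y) and ¬ t(y + 3w) = ¬ t(y).
¬agree-3n+1 : ∀ b {P} → let w = 2 ^ b ; N = 2 ^ (2 + b) ; m = 2 * (3 * w) + 1 in
  P + 3 ≤ N → ¬ Agree N m P (P + m)
¬agree-3n+1 b {P} P+3≤N agree with round-up-even P
... | y , r , r≤1 , P+r≡2y = not-¬ refl tm-y≡not-tm-y
  where
  w = 2 ^ b
  m = 2 * (3 * w) + 1
  N = 2 * (2 * w)

  Nr<m : N * r < m
  Nr<m = ≤-<-trans (≤-trans (*-monoʳ-≤ N r≤1) (≤-reflexive (*-identityʳ N)))
                   (≤-<-trans (*-monoʳ-≤ 2 (*-monoˡ-≤ w {2} {3} (s≤s (s≤s z≤n)))) (m<m+n _ (s≤s z≤n)))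

  y<2w : y < 2 * w
  y<2w = *-cancelˡ-≤ 2 (begin
    2 * suc y     ≡⟨ 2[1+y]≡2y+2 y ⟩
    2 * y + 2     ≡⟨ cong (_+ 2) (sym P+r≡2y) ⟩
    P + r + 2     ≡⟨ +-assoc P r 2 ⟩
    P + (r + 2)   ≤⟨ +-monoʳ-≤ P (+-monoˡ-≤ 2 r≤1) ⟩
    P + 3         ≤⟨ P+3≤N ⟩
    N             ∎)
    where
    open ≤-Reasoning
    2[1+y]≡2y+2 : ∀ y → 2 * suc y ≡ 2 * y + 2
    2[1+y]≡2y+2 = solve-∀

  tm-y≡not-tm-y : tm y ≡ not (tm y)
  tm-y≡not-tm-y = begin
    tm y                       ≡⟨ sym (tm-2n y) ⟩
    tm (2 * y)                 ≡⟨ cong tm (sym P+r≡2y) ⟩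
    tm (P + r)                 ≡⟨ agree r Nr<m ⟩
    tm (P + m + r)             ≡⟨ cong tm (trans (swap P m r) (cong (_+ m) P+r≡2y)) ⟩
    tm (2 * y + m)             ≡⟨ cong tm (regroup y w) ⟩
    tm (2 * (y + 3 * w) + 1)   ≡⟨ tm-2n+1 (y + 3 * w) ⟩
    not (tm (y + 3 * w))       ≡⟨ cong not (tm-+3*2^ b y<2w) ⟩
    not (tm y)                 ∎
    where
    open ≡-Reasoning
    swap : ∀ x y z → x + y + z ≡ x + z + y
    swap = solve-∀
    regroup : ∀ y w → 2 * y + (2 * (3 * w) + 1) ≡ 2 * (y + 3 * w) + 1
    regroup = solve-∀

-- Since P + r + m = 2^(a+2) + (P + r + 3), agreement at r = 0, 1 contradicts tm-no-double-antiperiod-3.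
¬agree-4n+3 : ∀ a {P} → let n = 2 ^ a ; N = 2 ^ suc a ; m = 2 * (2 * n + 1) + 1 in
  P + 5 ≤ 2 * N → ¬ Agree N m P (P + m)
¬agree-4n+3 a {P} P+5≤2N agree =
  tm-no-double-antiperiod-3 P
    (subst₂ (λ i j → tm i ≡ not (tm j)) (+-identityʳ P) (cong (_+ 3) (+-identityʳ P)) (antiperiod 0 z≤n))
    (subst (λ j → tm (P + 1) ≡ not (tm j)) (+-assoc P 1 3) (antiperiod 1 (s≤s z≤n)))
  where
  n = 2 ^ a
  N = 2 * n
  m = 2 * (2 * n + 1) + 1

  Nr<m : ∀ {r} → r ≤ 1 → N * r < m
  Nr<m r≤1 = ≤-<-trans (≤-trans (*-monoʳ-≤ N r≤1) (≤-reflexive (*-identityʳ N)))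
                      (≤-<-trans (*-monoʳ-≤ 2 (≤-trans (m≤m+n n (1 * n)) (m≤m+n (2 * n) 1))) (m<m+n _ (s≤s z≤n)))

  P+r+3<2N : ∀ {r} → r ≤ 1 → P + r + 3 < 2 * N
  P+r+3<2N {r} r≤1 = begin-strict
    P + r + 3    ≡⟨ +-assoc P r 3 ⟩
    P + (r + 3)  ≤⟨ +-monoʳ-≤ P (+-monoˡ-≤ 3 r≤1) ⟩
    P + 4        <⟨ +-monoʳ-< P (n<1+n 4) ⟩
    P + 5        ≤⟨ P+5≤2N ⟩
    2 * N        ∎
    where open ≤-Reasoning

  antiperiod : ∀ r → r ≤ 1 → tm (P + r) ≡ not (tm (P + r + 3))
  antiperiod r r≤1 = begin
    tm (P + r)                         ≡⟨ agree r (Nr<m r≤1) ⟩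
    tm (P + m + r)                     ≡⟨ cong tm (regroup P n r) ⟩
    tm (2 ^ (2 + a) * 1 + (P + r + 3)) ≡⟨ tm-split (2 + a) 1 (P+r+3<2N r≤1) ⟩
    tm 1 xor tm (P + r + 3)            ≡⟨ true-xor (tm (P + r + 3)) ⟩
    not (tm (P + r + 3))               ∎
    where
    open ≡-Reasoning
    regroup : ∀ P n r → P + (2 * (2 * n + 1) + 1) + r ≡ 2 * (2 * n) * 1 + (P + r + 3)
    regroup = solve-∀

offset-bound-3n+1 : ∀ w k P → 0 < w → let n = 2 * w ; m = 2 * (3 * w) + 1 in
  3 * k + 10 ≤ 10 * n → m + 2 * n * (P + m) ≤ k * m → P + 3 ≤ 2 * n
offset-bound-3n+1 (suc w) k P _ k-small repeat =
  *-cancelˡ-≤ (12 * suc w) (+-cancelʳ-≤ E _ _ (begin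
    12 * suc w * (P + 3) + E              ≡⟨ lhs (suc w) P ⟩
    3 * (m + 2 * n * (P + m)) + 10 * m    ≤⟨ +-monoˡ-≤ (10 * m) (*-monoʳ-≤ 3 repeat) ⟩
    3 * (k * m) + 10 * m                  ≡⟨ collect k m ⟩
    (3 * k + 10) * m                      ≤⟨ *-monoˡ-≤ m k-small ⟩
    10 * n * m                            ≤⟨ m≤m+n (10 * n * m) (34 * suc w + 13) ⟩
    10 * n * m + (34 * suc w + 13)        ≡⟨ rhs (suc w) ⟩
    12 * suc w * (2 * n) + E              ∎))
  where
  open ≤-Reasoning
  n = 2 * suc w
  m = 2 * (3 * suc w) + 1
  E = 72 * suc w * suc w + 54 * suc w + 13
  lhs : ∀ w P → 12 * w * (P + 3) + (72 * w * w + 54 * w + 13)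
              ≡ 3 * ((2 * (3 * w) + 1) + 2 * (2 * w) * (P + (2 * (3 * w) + 1))) + 10 * (2 * (3 * w) + 1)
  lhs = solve-∀
  collect : ∀ k m → 3 * (k * m) + 10 * m ≡ (3 * k + 10) * m
  collect = solve-∀
  rhs : ∀ w → 10 * (2 * w) * (2 * (3 * w) + 1) + (34 * w + 13)
              ≡ 12 * w * (2 * (2 * w)) + (72 * w * w + 54 * w + 13)
  rhs = solve-∀

offset-bound-4n+3 : ∀ n k P → 0 < n → let m = 2 * (2 * n + 1) + 1 in
  k + 3 ≤ 4 * n → m + 2 * n * (P + m) ≤ k * m → P + 5 ≤ 2 * (2 * n)
offset-bound-4n+3 (suc n) k P _ k-small repeat =
  *-cancelˡ-≤ (2 * suc n) (+-cancelʳ-≤ E _ _ (begin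
    2 * suc n * (P + 5) + E               ≡⟨ lhs (suc n) P ⟩
    m + 2 * suc n * (P + m) + 3 * m       ≤⟨ +-monoˡ-≤ (3 * m) repeat ⟩
    k * m + 3 * m                         ≡⟨ sym (*-distribʳ-+ m k 3) ⟩
    (k + 3) * m                           ≤⟨ *-monoˡ-≤ m k-small ⟩
    4 * suc n * m                         ≤⟨ m≤m+n (4 * suc n * m) 12 ⟩
    4 * suc n * m + 12                    ≡⟨ rhs (suc n) ⟩
    2 * suc n * (2 * (2 * suc n)) + E     ∎))
  where
  open ≤-Reasoning
  m = 2 * (2 * suc n + 1) + 1
  E = 8 * suc n * suc n + 12 * suc n + 12
  lhs : ∀ n P → 2 * n * (P + 5) + (8 * n * n + 12 * n + 12)
              ≡ (2 * (2 * n + 1) + 1) + 2 * n * (P + (2 * (2 * n + 1) + 1)) + 3 * (2 * (2 * n + 1) + 1)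
  lhs = solve-∀
  rhs : ∀ n → 4 * n * (2 * (2 * n + 1) + 1) + 12 ≡ 2 * n * (2 * (2 * n)) + (8 * n * n + 12 * n + 12)
  rhs = solve-∀

3n+1∈F : ∀ b k → 3 * k + 10 ≤ 10 * 2 ^ suc b → InF k (3 * 2 ^ suc b + 1)
3n+1∈F b k k-small = subst (InF k) (cong (_+ 1) (2[3w]≡3[2w] w)) (∈F-criterion (suc b) (3 * w) k 3n<m k≤2N no-agreement)
  where
  w = 2 ^ b
  m = 2 * (3 * w) + 1
  N = 2 * (2 * w)
  2[3w]≡3[2w] : ∀ w → 2 * (3 * w) ≡ 3 * (2 * w)
  2[3w]≡3[2w] = solve-∀
  3n<m : 3 * (2 * w) < m
  3n<m = subst (_< m) (2[3w]≡3[2w] w) (m<m+n (2 * (3 * w)) (s≤s z≤n))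
  k≤2N : k ≤ 2 * N
  k≤2N = *-cancelˡ-≤ 3 (begin
    3 * k           ≤⟨ m≤m+n (3 * k) 10 ⟩
    3 * k + 10      ≤⟨ k-small ⟩
    10 * (2 * w)    ≤⟨ *-monoˡ-≤ (2 * w) {10} {12} (m≤m+n 10 2) ⟩
    12 * (2 * w)    ≡⟨ 12[2w]≡3[2N] w ⟩
    3 * (2 * N)     ∎)
    where
    open ≤-Reasoning
    12[2w]≡3[2N] : ∀ w → 12 * (2 * w) ≡ 3 * (2 * (2 * (2 * w)))
    12[2w]≡3[2N] = solve-∀
  no-agreement : ∀ P → m + N * (P + m) ≤ k * m → ¬ Agree N m P (P + m)
  no-agreement P repeat = ¬agree-3n+1 b (offset-bound-3n+1 w k P (m^n>0 2 b) k-small repeat)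

4n+3∈F : ∀ a k → k + 3 ≤ 4 * 2 ^ a → InF k (4 * 2 ^ a + 3)
4n+3∈F a k k-small = subst (InF k) (2[2n+1]+1≡4n+3 n) (∈F-criterion a (2 * n + 1) k 3n<m k≤2N no-agreement)
  where
  n = 2 ^ a
  m = 2 * (2 * n + 1) + 1
  N = 2 * n
  2[2n+1]+1≡4n+3 : ∀ n → 2 * (2 * n + 1) + 1 ≡ 4 * n + 3
  2[2n+1]+1≡4n+3 = solve-∀
  3n<m : 3 * n < m
  3n<m = subst (3 * n <_) (sym (2[2n+1]+1≡4n+3 n))
               (≤-<-trans (*-monoˡ-≤ n {3} {4} (m≤m+n 3 1)) (m<m+n (4 * n) (s≤s z≤n)))
  k≤2N : k ≤ 2 * N
  k≤2N = ≤-trans (m≤m+n k 3) (≤-trans k-small (≤-reflexive (4n≡2[2n] n)))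
    where
    4n≡2[2n] : ∀ n → 4 * n ≡ 2 * (2 * n)
    4n≡2[2n] = solve-∀
  no-agreement : ∀ P → m + N * (P + m) ≤ k * m → ¬ Agree N m P (P + m)
  no-agreement P repeat = ¬agree-4n+3 a (offset-bound-4n+3 n k P (m^n>0 2 a) k-small repeat)

-- Existence of γ(k)

least-witness : ∀ {P : ℕ → Set} → Decidable P → ∀ {n} → P n → ∃ λ g → P g × (∀ x → P x → g ≤ x)
least-witness {P} P? {n} Pn = search 0 n (λ _ ()) (subst P (sym (+-identityʳ n)) Pn)
  where
  search : ∀ lo d → (∀ x → x < lo → ¬ P x) → P (d + lo) → ∃ λ g → P g × (∀ x → P x → g ≤ x)
  search lo zero    none-below Plo = lo , Plo , λ x Px → ≮⇒≥ (λ x<lo → none-below x x<lo Px)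
  search lo (suc d) none-below Pd+lo with P? lo
  ... | yes Plo = lo , Plo , λ x Px → ≮⇒≥ (λ x<lo → none-below x x<lo Px)
  ... | no ¬Plo = search (suc lo) d none-below′ (subst P (sym (+-suc d lo)) Pd+lo)
    where
    none-below′ : ∀ x → x < suc lo → ¬ P x
    none-below′ x x<1+lo with m≤n⇒m<n∨m≡n (s≤s⁻¹ x<1+lo)
    ... | inj₁ x<lo = none-below x x<lo
    ... | inj₂ refl = ¬Plo

inF? : ∀ k m → Dec (InF k m)
inF? k m = (m % 2 ≟ 1) ×-dec map′ (block-lengths k m ,_) proj₂
  (all? λ i → all? λ j → ¬? (i ≟ᶠ j) →-dec ¬? (≡-dec _≟ᴮ_ (block m (toℕ i)) (block m (toℕ j))))

γ-exists : ∀ {k m} → InF k m → ∃ λ g → IsGamma k g × g ≤ m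
γ-exists {k} m∈F =
  let g , g∈F , minimal = least-witness (inF? k) m∈F
  in  g , (g∈F , minimal) , minimal _ m∈F

-- The lim inf

base4-repunit : ℕ → ℕ
base4-repunit zero    = 1
base4-repunit (suc c) = suc (4 * base4-repunit c)

3*repunit+1≡2^[2+2c] : ∀ c → 3 * base4-repunit c + 1 ≡ 2 ^ (2 + 2 * c)
3*repunit+1≡2^[2+2c] zero    = refl
3*repunit+1≡2^[2+2c] (suc c) = begin
  3 * suc (4 * u) + 1        ≡⟨ unfold u ⟩
  4 * (3 * u + 1)            ≡⟨ cong (4 *_) (3*repunit+1≡2^[2+2c] c) ⟩
  4 * 2 ^ (2 + 2 * c)        ≡⟨ 4x≡2[2x] (2 ^ (2 + 2 * c)) ⟩
  2 ^ (2 + (2 + 2 * c))      ≡⟨ cong (2 ^_) (exponent c) ⟩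
  2 ^ (2 + 2 * suc c)        ∎
  where
  open ≡-Reasoning
  u = base4-repunit c
  unfold : ∀ u → 3 * suc (4 * u) + 1 ≡ 4 * (3 * u + 1)
  unfold = solve-∀
  4x≡2[2x] : ∀ x → 4 * x ≡ 2 * (2 * x)
  4x≡2[2x] = solve-∀
  exponent : ∀ c → 2 + (2 + 2 * c) ≡ 2 + 2 * suc c
  exponent = solve-∀

c<repunit : ∀ c → c < base4-repunit c
c<repunit zero    = s≤s z≤n
c<repunit (suc c) = s≤s (≤-trans (c<repunit c) (m≤n*m (base4-repunit c) 4))

liminf-ratio : ∀ d u g → suc d ≤ u → g ≤ 3 * (3 * u + 1) + 1 →
  10 * suc d * g < 9 * suc d * (10 * u) + 10 * (10 * u)
liminf-ratio d (suc u) g D≤u g≤m = begin-strict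
  10 * D * g                               ≤⟨ *-monoʳ-≤ (10 * D) g≤m ⟩
  10 * D * (3 * (3 * suc u + 1) + 1)       ≡⟨ expand D (suc u) ⟩
  90 * D * suc u + 40 * D                  ≤⟨ +-monoʳ-≤ (90 * D * suc u) (*-monoʳ-≤ 40 D≤u) ⟩
  90 * D * suc u + 40 * suc u              <⟨ +-monoʳ-< (90 * D * suc u) (*-monoˡ-< (suc u) {40} {100} (m<m+n 40 (s≤s z≤n))) ⟩
  90 * D * suc u + 100 * suc u             ≡⟨ collect D (suc u) ⟩
  9 * D * (10 * suc u) + 10 * (10 * suc u) ∎
  where
  open ≤-Reasoning
  D = suc d
  expand : ∀ D u → 10 * D * (3 * (3 * u + 1) + 1) ≡ 90 * D * u + 40 * D
  expand = solve-∀
  collect : ∀ D u → 90 * D * u + 100 * u ≡ 9 * D * (10 * u) + 10 * (10 * u)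
  collect = solve-∀

-- k = 10u with 3u + 1 = 4^(c+1), and m = 3 · 4^(c+1) + 1 = 9u + 4.
liminf-witness : ∀ d N → Σ ℕ λ k → (N ≤ k) × (1 ≤ k) × Σ ℕ λ g →
  IsGamma k g × (10 * suc d * g < 9 * suc d * k + 10 * k)
liminf-witness d N =
  let g , isγ , g≤m = γ-exists (3n+1∈F (suc (2 * c)) k 3k+10≤10n)
  in  k , ≤-trans (m≤m+n N d) (<⇒≤ c<k) , ≤-trans (s≤s z≤n) c<k , g , isγ ,
      liminf-ratio d u g D≤u (subst (λ n → g ≤ 3 * n + 1) (sym (3*repunit+1≡2^[2+2c] c)) g≤m)
  where
  c = N + d
  u = base4-repunit c
  k = 10 * u
  c<k : c < k
  c<k = <-≤-trans (c<repunit c) (m≤n*m u 10)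
  D≤u : suc d ≤ u
  D≤u = ≤-trans (s≤s (m≤n+m d N)) (c<repunit c)
  3k+10≤10n : 3 * k + 10 ≤ 10 * 2 ^ (2 + 2 * c)
  3k+10≤10n = ≤-reflexive (trans (regroup u) (cong (10 *_) (3*repunit+1≡2^[2+2c] c)))
    where
    regroup : ∀ u → 3 * (10 * u) + 10 ≡ 10 * (3 * u + 1)
    regroup = solve-∀

-- The lim sup

dyadic : ∀ x → ∃ λ e → 2 ^ e ≤ suc x × suc x < 2 ^ suc e
dyadic zero = 0 , ≤-refl , s≤s (s≤s z≤n)
dyadic (suc x) with dyadic x
... | e , lo , hi with 2 + x <? 2 ^ suc e
...   | yes hi′ = e , m≤n⇒m≤1+n lo , hi′
...   | no ¬hi′ = suc e , ≤-reflexive (sym 2+x≡2^[1+e]) , subst (_< 2 ^ suc (suc e)) (sym 2+x≡2^[1+e]) p<2p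
  where
  2+x≡2^[1+e] : 2 + x ≡ 2 ^ suc e
  2+x≡2^[1+e] = ≤-antisym hi (≮⇒≥ ¬hi′)
  p<2p : 2 ^ suc e < 2 * 2 ^ suc e
  p<2p = subst (_< 2 * 2 ^ suc e) (*-identityˡ (2 ^ suc e))
               (*-monoˡ-< (2 ^ suc e) {{m^n≢0 2 (suc e)}} {1} {2} (s≤s (s≤s z≤n)))

GammaBelow3/2 : ℕ → ℕ → Set
GammaBelow3/2 d k = Σ ℕ λ g → IsGamma k g × (2 * suc d * g < 3 * suc d * k + 2 * k)

ratio-3n+1 : ∀ d n k g → 6 * d + 40 ≤ k → 2 * n ≤ 3 + k → g ≤ 3 * n + 1 →
  2 * suc d * g < 3 * suc d * k + 2 * k
ratio-3n+1 d n k g k-large 2n≤3+k g≤m = begin-strict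
  2 * D * g                  ≤⟨ *-monoʳ-≤ (2 * D) g≤m ⟩
  2 * D * (3 * n + 1)        ≡⟨ expand D n ⟩
  3 * D * (2 * n) + 2 * D    ≤⟨ +-monoˡ-≤ (2 * D) (*-monoʳ-≤ (3 * D) 2n≤3+k) ⟩
  3 * D * (3 + k) + 2 * D    ≡⟨ collect D k ⟩
  3 * D * k + 11 * D         <⟨ +-monoʳ-< (3 * D * k) 11D<2k ⟩
  3 * D * k + 2 * k          ∎
  where
  open ≤-Reasoning
  D = suc d
  expand : ∀ D n → 2 * D * (3 * n + 1) ≡ 3 * D * (2 * n) + 2 * D
  expand = solve-∀
  collect : ∀ D k → 3 * D * (3 + k) + 2 * D ≡ 3 * D * k + 11 * D
  collect = solve-∀
  11D<2k : 11 * D < 2 * k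
  11D<2k = <-≤-trans (subst (11 * D <_) (slack d) (m<m+n (11 * D) (s≤s z≤n))) (*-monoʳ-≤ 2 k-large)
    where
    slack : ∀ d → 11 * suc d + suc (d + 68) ≡ 2 * (6 * d + 40)
    slack = solve-∀

ratio-4n+3 : ∀ d n k g → 3 ≤ n → 3 * n < k → g ≤ 4 * n + 3 →
  2 * suc d * g < 3 * suc d * k + 2 * k
ratio-4n+3 d n k g 3≤n 3n<k g≤m = begin-strict
  2 * D * g                   ≤⟨ *-monoʳ-≤ (2 * D) g≤m ⟩
  2 * D * (4 * n + 3)         ≡⟨ expand D n ⟩
  8 * D * n + 3 * D + 3 * D   ≤⟨ +-monoʳ-≤ (8 * D * n + 3 * D) (subst (_≤ D * n) (*-comm D 3) (*-monoʳ-≤ D 3≤n)) ⟩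
  8 * D * n + 3 * D + D * n   ≡⟨ collect D n ⟩
  3 * D * (1 + 3 * n)         ≤⟨ *-monoʳ-≤ (3 * D) 3n<k ⟩
  3 * D * k                   <⟨ m<m+n (3 * D * k) (*-monoʳ-< 2 (≤-trans (s≤s z≤n) 3n<k)) ⟩
  3 * D * k + 2 * k           ∎
  where
  open ≤-Reasoning
  D = suc d
  expand : ∀ D n → 2 * D * (4 * n + 3) ≡ 8 * D * n + 3 * D + 3 * D
  expand = solve-∀
  collect : ∀ D n → 8 * D * n + 3 * D + D * n ≡ 3 * D * (1 + 3 * n)
  collect = solve-∀

large-k⇒11≤n : ∀ d k n → 6 * d + 40 ≤ k → 3 + k < 2 * (2 * n) → 11 ≤ n
large-k⇒11≤n d k n k-large 3+k<4n = *-cancelˡ-≤ 4 (begin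
  44             ≤⟨ +-monoʳ-≤ 4 (≤-trans (m≤n+m 40 (6 * d)) k-large) ⟩
  4 + k          ≤⟨ 3+k<4n ⟩
  2 * (2 * n)    ≡⟨ 2[2n]≡4n n ⟩
  4 * n          ∎)
  where
  open ≤-Reasoning
  2[2n]≡4n : ∀ n → 2 * (2 * n) ≡ 4 * n
  2[2n]≡4n = solve-∀

limsup-3n+1 : ∀ d k a → let n = 2 ^ a in
  6 * d + 40 ≤ k → 2 * n ≤ 3 + k → 3 + k < 2 * (2 * n) → k ≤ 3 * n → GammaBelow3/2 d k
limsup-3n+1 d k zero    k-large _ 3+k<4 _ = ⊥-elim (<⇒≱ (s≤s (s≤s z≤n)) (large-k⇒11≤n d k 1 k-large 3+k<4))
limsup-3n+1 d k (suc b) k-large 2n≤3+k 3+k<4n k≤3n =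
  let g , isγ , g≤m = γ-exists (3n+1∈F b k 3k+10≤10n)
  in  g , isγ , ratio-3n+1 d n k g k-large 2n≤3+k g≤m
  where
  n = 2 ^ suc b
  3k+10≤10n : 3 * k + 10 ≤ 10 * n
  3k+10≤10n = begin
    3 * k + 10         ≤⟨ +-mono-≤ (*-monoʳ-≤ 3 k≤3n) (≤-trans (m≤m+n 10 1) (large-k⇒11≤n d k n k-large 3+k<4n)) ⟩
    3 * (3 * n) + n    ≡⟨ collect n ⟩
    10 * n             ∎
    where
    open ≤-Reasoning
    collect : ∀ n → 3 * (3 * n) + n ≡ 10 * n
    collect = solve-∀

limsup-4n+3 : ∀ d k a → let n = 2 ^ a in
  6 * d + 40 ≤ k → 3 + k < 2 * (2 * n) → 3 * n < k → GammaBelow3/2 d k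
limsup-4n+3 d k a k-large 3+k<4n 3n<k =
  let g , isγ , g≤m = γ-exists (4n+3∈F a k k+3≤4n)
  in  g , isγ , ratio-4n+3 d n k g (≤-trans (m≤m+n 3 8) (large-k⇒11≤n d k n k-large 3+k<4n)) 3n<k g≤m
  where
  n = 2 ^ a
  k+3≤4n : k + 3 ≤ 4 * n
  k+3≤4n = subst₂ _≤_ (+-comm 3 k) (2[2n]≡4n n) (<⇒≤ 3+k<4n)
    where
    2[2n]≡4n : ∀ n → 2 * (2 * n) ≡ 4 * n
    2[2n]≡4n = solve-∀

-- The threshold 6d + 40 gives 11 (d + 1) < 2k for ratio-3n+1 and n ≥ 11 for the choice of n.
limsup-witness : ∀ d k → 6 * d + 40 ≤ k → GammaBelow3/2 d k
limsup-witness d k k-large with dyadic (2 + k)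
... | zero  , _ , 3+k<2 = ⊥-elim (<⇒≱ 3+k<2 (s≤s (s≤s z≤n)))
... | suc a , 2n≤3+k , 3+k<4n with k ≤? 3 * 2 ^ a
...   | yes k≤3n = limsup-3n+1 d k a k-large 2n≤3+k 3+k<4n k≤3n
...   | no  k≰3n = limsup-4n+3 d k a k-large 3+k<4n (≰⇒> k≰3n)

theorem4 :
  ((d N : ℕ) → Σ ℕ λ k → (N ≤ k) × (1 ≤ k) × Σ ℕ λ g →
      IsGamma k g × (10 * (suc d) * g < 9 * (suc d) * k + 10 * k))
  × ((d : ℕ) → Σ ℕ λ N → (k : ℕ) → N ≤ k → 1 ≤ k → Σ ℕ λ g →
      IsGamma k g × (2 * (suc d) * g < 3 * (suc d) * k + 2 * k))
theorem4 = liminf-witness , λ d → 6 * d + 40 , λ k k-large _ → limsup-witness d k k-large
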